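{- Let $k \geq 0$, $r \geq 3$ and $n \geq k(r+1) - 1$ be integers. For every graph $G$ on $n$ vertices with $\delta(G) \geq n - k$ and every set $A \subseteq V(G)$ with $|A| = r$, we have $\langle A \rangle_r = V(G)$.
   Context: Graphs are finite and simple; $\delta(G)$ is the minimum degree and $N(v)$ the neighbourhood of $v$. For an integer $r \geq 2$, the $r$-neighbour bootstrap process on $G$ started from $A \subseteq V(G)$ is defined by $A_0 = A$ and $A_t = A_{t-1} \cup \{v \in V(G) : |N(v) \cap A_{t-1}| \geq r\}$ for $t \geq 1$. The closure is $\langle A \rangle_r = \bigcup_{t \geq 0} A_t$. -}

module Defs where

open import Data.Nat using (ℕ; zero; suc; _≤_)
open import Data.Bool using (Bool; true; false; _∧_; _∨_; if_then_else_)
open import Data.Fin using (Fin)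
open import Data.Fin.Subset using (Subset; _∈_; ∣_∣)
open import Data.Vec using (Vec; lookup; tabulate; count)
open import Data.Vec.Functional as VF using ()
open import Data.Product using (Σ; ∃; _×_)
open import Relation.Binary.PropositionalEquality using (_≡_)
open import Relation.Nullary using (¬_)
open import Data.List using (List; filter; length; allFin)
open import Relation.Nullary.Decidable using (Dec)

record Graph (n : ℕ) : Set where
  field
    adj     : Fin n → Fin n → Bool
    sym     : ∀ u v → adj u v ≡ adj v u
    irrefl  : ∀ v → adj v v ≡ false
open Graph public

countB : ∀ {n} → (Fin n → Bool) → ℕ
countB {n} p = count (λ b → Data.Bool._≟_ b true) (tabulate p)
  where import Data.Bool

degree : ∀ {n} → Graph n → Fin n → ℕ
degree G v = countB (adj G v)

minDegree≥ : ∀ {n} → Graph n → ℕ → Set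
minDegree≥ G d = ∀ v → d ≤ degree G v

nbrsIn : ∀ {n} → Graph n → Subset n → Fin n → ℕ
nbrsIn G S v = countB (λ w → adj G v w ∧ lookup S w)

step : ∀ {n} → Graph n → ℕ → Subset n → Subset n
step G r S = tabulate λ v → lookup S v ∨ isYes (r Data.Nat.≤? nbrsIn G S v)
  where
    import Data.Nat
    open import Relation.Nullary.Decidable using (isYes)

bootstrap : ∀ {n} → Graph n → ℕ → Subset n → ℕ → Subset n
bootstrap G r A zero    = A
bootstrap G r A (suc t) = step G r (bootstrap G r A t)

InClosure : ∀ {n} → Graph n → ℕ → Subset n → Fin n → Set
InClosure G r A v = ∃ λ t → v ∈ bootstrap G r A t

Percolates : ∀ {n} → Graph n → ℕ → Subset n → Set
Percolates G r A = ∀ v → InClosure G r A v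

-- After one round every vertex w outside A₁ = step A is a non-neighbour of some
-- a ∈ A (it has fewer than r = |A| neighbours in A), and each vertex has at most
-- k − 1 non-neighbours besides itself, so |V ∖ A₁| ≤ r(k − 1).  A vertex v ∉ A₁
-- then misses at most k − 1 vertices of A₁, so it has at least
-- n − r(k − 1) − (k − 1) ≥ r neighbours in A₁, and A₂ = V.
module Submission where

open import Defs hiding (sym)
open import Data.Nat using (ℕ; zero; suc; _≤_; _<_; _+_; _*_; _∸_; _≤?_; z≤n; s≤s; s≤s⁻¹)
open import Data.Nat.Properties
open import Data.Nat.Tactic.RingSolver using (solve-∀)
open import Data.Bool using (Bool; true; _∧_; _∨_)
open import Data.Bool.Properties using (∨-zeroʳ)
open import Data.Fin using (Fin) renaming (zero to fzero; suc to fsuc)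
open import Data.Fin.Properties using (any?)
open import Data.Fin.Subset
open import Data.Fin.Subset.Properties
open import Data.Vec using (_∷_; []; lookup; tabulate; here; there)
open import Data.Vec.Properties using (lookup∘tabulate; lookup⇒[]=; []=⇒lookup)
open import Data.Product using (∃; _×_; _,_)
open import Data.Sum using (_⊎_; inj₁; inj₂)
open import Data.Empty using (⊥-elim)
open import Function using (_∘_)
open import Relation.Binary.PropositionalEquality using (_≡_; _≢_; refl; sym; trans; cong; subst)
open import Relation.Nullary using (yes; no; contradiction)
open import Relation.Nullary.Decidable using (isYes; isYes≗does; dec-true; decidable-stable; ¬?; _×-dec_)

∣p∪q∣≤∣p∣+∣q∣ : ∀ {n} (p q : Subset n) → ∣ p ∪ q ∣ ≤ ∣ p ∣ + ∣ q ∣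
∣p∪q∣≤∣p∣+∣q∣ []            []            = z≤n
∣p∪q∣≤∣p∣+∣q∣ (inside  ∷ p) (t       ∷ q) = s≤s (≤-trans (∣p∪q∣≤∣p∣+∣q∣ p q) (+-monoʳ-≤ ∣ p ∣ (∣p∣≤∣x∷p∣ t q)))
∣p∪q∣≤∣p∣+∣q∣ (outside ∷ p) (inside  ∷ q) = ≤-trans (s≤s (∣p∪q∣≤∣p∣+∣q∣ p q)) (≤-reflexive (sym (+-suc ∣ p ∣ ∣ q ∣)))
∣p∪q∣≤∣p∣+∣q∣ (outside ∷ p) (outside ∷ q) = ∣p∪q∣≤∣p∣+∣q∣ p q

∣p∣+∣∁p∣≡n : ∀ {n} (p : Subset n) → ∣ p ∣ + ∣ ∁ p ∣ ≡ n
∣p∣+∣∁p∣≡n p = trans (cong (∣ p ∣ +_) (∣∁p∣≡n∸∣p∣ p)) (m+[n∸m]≡n (∣p∣≤n p))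

p⊈q⇒∃ : ∀ {n} {p q : Subset n} → p ⊈ q → ∃ λ x → x ∈ p × x ∉ q
p⊈q⇒∃ {p = p} {q} p⊈q with any? (λ x → x ∈? p ×-dec ¬? (x ∈? q))
... | yes witness = witness
... | no ∄ = contradiction (λ {x} x∈p → decidable-stable (x ∈? q) (λ x∉q → ∄ (x , x∈p , x∉q))) p⊈q

∣q∩p∣<∣p∣⇒∃ : ∀ {n} (p q : Subset n) → ∣ q ∩ p ∣ < ∣ p ∣ → ∃ λ x → x ∈ p × x ∉ q
∣q∩p∣<∣p∣⇒∃ p q lt = p⊈q⇒∃ λ p⊆q → <⇒≱ lt (p⊆q⇒∣p∣≤∣q∣ (λ x∈p → x∈p∩q⁺ (p⊆q x∈p , x∈p)))

tabulate-∧-lookup : ∀ {n} (f : Fin n → Bool) (S : Subset n) →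
  tabulate (λ i → f i ∧ lookup S i) ≡ tabulate f ∩ S
tabulate-∧-lookup f []      = refl
tabulate-∧-lookup f (s ∷ S) = cong (f fzero ∧ s ∷_) (tabulate-∧-lookup (f ∘ fsuc) S)

⋃∈ : ∀ {m n} → Subset m → (Fin m → Subset n) → Subset n
⋃∈ []            f = ⊥
⋃∈ (inside  ∷ A) f = f fzero ∪ ⋃∈ A (f ∘ fsuc)
⋃∈ (outside ∷ A) f = ⋃∈ A (f ∘ fsuc)

x∈⋃∈⁺ : ∀ {m n} {A : Subset m} {f : Fin m → Subset n} {a x} → a ∈ A → x ∈ f a → x ∈ ⋃∈ A f
x∈⋃∈⁺                       here      x∈fa = p⊆p∪q _ x∈fa
x∈⋃∈⁺ {A = inside  ∷ A} {f} (there a∈A) x∈fa = q⊆p∪q (f fzero) _ (x∈⋃∈⁺ a∈A x∈fa)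
x∈⋃∈⁺ {A = outside ∷ A}     (there a∈A) x∈fa = x∈⋃∈⁺ a∈A x∈fa

∣⋃∈∣≤∣A∣* : ∀ {m n} (A : Subset m) (f : Fin m → Subset n) c →
  (∀ a → ∣ f a ∣ ≤ c) → ∣ ⋃∈ A f ∣ ≤ ∣ A ∣ * c
∣⋃∈∣≤∣A∣* {n = n} []  f c _ = ≤-reflexive (∣⊥∣≡0 n)
∣⋃∈∣≤∣A∣* (inside  ∷ A) f c ∣f∣≤c =
  ≤-trans (∣p∪q∣≤∣p∣+∣q∣ (f fzero) _) (+-mono-≤ (∣f∣≤c fzero) (∣⋃∈∣≤∣A∣* A (f ∘ fsuc) c (∣f∣≤c ∘ fsuc)))
∣⋃∈∣≤∣A∣* (outside ∷ A) f c ∣f∣≤c = ∣⋃∈∣≤∣A∣* A (f ∘ fsuc) c (∣f∣≤c ∘ fsuc)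

module _ {n} (G : Graph n) where

  N : Fin n → Subset n
  N v = tabulate (adj G v)

  nonNeighbours : Fin n → Subset n
  nonNeighbours v = ∁ (N v) - v

  ∈N⇒adj : ∀ {v w} → w ∈ N v → adj G v w ≡ true
  ∈N⇒adj {v} {w} w∈N = trans (sym (lookup∘tabulate (adj G v) w)) ([]=⇒lookup w∈N)

  adj⇒∈N : ∀ {v w} → adj G v w ≡ true → w ∈ N v
  adj⇒∈N {v} {w} e = lookup⇒[]= w (N v) (trans (lookup∘tabulate (adj G v) w) e)

  v∉N[v] : ∀ v → v ∉ N v
  v∉N[v] v v∈N with trans (sym (∈N⇒adj v∈N)) (irrefl G v)
  ... | ()

  ∈N-sym : ∀ {v w} → w ∈ N v → v ∈ N w
  ∈N-sym {v} {w} w∈N = adj⇒∈N (trans (Graph.sym G w v) (∈N⇒adj w∈N))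

  nbrsIn≡∣N∩∣ : ∀ S v → nbrsIn G S v ≡ ∣ N v ∩ S ∣
  nbrsIn≡∣N∩∣ S v = cong ∣_∣ (tabulate-∧-lookup (adj G v) S)

  ∈nonNeighbours : ∀ {v w} → w ∉ N v → w ≢ v → w ∈ nonNeighbours v
  ∈nonNeighbours {v} w∉N w≢v = x∈p∧x∉q⇒x∈p─q (x∉p⇒x∈∁p w∉N) (w≢v ∘ x∈⁅y⁆⇒x≡y v)

  ∣nonNeighbours∣<k : ∀ {k} → minDegree≥ G (n ∸ k) → ∀ v → ∣ nonNeighbours v ∣ < k
  ∣nonNeighbours∣<k {k} δ≥ v = <-≤-trans (x∈p⇒∣p-x∣<∣p∣ (x∉p⇒x∈∁p (v∉N[v] v))) ∣∁N∣≤k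
    where
    ∣∁N∣≤k : ∣ ∁ (N v) ∣ ≤ k
    ∣∁N∣≤k = begin
      ∣ ∁ (N v) ∣      ≡⟨ ∣∁p∣≡n∸∣p∣ (N v) ⟩
      n ∸ ∣ N v ∣      ≤⟨ ∸-monoʳ-≤ n (δ≥ v) ⟩
      n ∸ (n ∸ k)      ≤⟨ m≤n+o⇒m∸n≤o n (n ∸ k) (≤-trans (m≤n+m∸n n k) (≤-reflexive (+-comm k _))) ⟩
      k                ∎
      where open ≤-Reasoning

  ∈-step⁺ : ∀ {r S v} → v ∈ S ⊎ r ≤ ∣ N v ∩ S ∣ → v ∈ step G r S
  ∈-step⁺ {r} {S} {v} cond = lookup⇒[]= v (step G r S) (trans (lookup∘tabulate _ v) (holds cond))
    where
    holds : v ∈ S ⊎ r ≤ ∣ N v ∩ S ∣ → lookup S v ∨ isYes (r ≤? nbrsIn G S v) ≡ true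
    holds (inj₁ v∈S) = cong (_∨ isYes (r ≤? nbrsIn G S v)) ([]=⇒lookup v∈S)
    holds (inj₂ r≤)  = trans (cong (lookup S v ∨_) (trans (isYes≗does (r ≤? _)) (dec-true (r ≤? _) r≤′)))
                             (∨-zeroʳ (lookup S v))
      where
      r≤′ : r ≤ nbrsIn G S v
      r≤′ = subst (r ≤_) (sym (nbrsIn≡∣N∩∣ S v)) r≤

  ∉-step⁻ : ∀ {r S v} → v ∉ step G r S → v ∉ S × ∣ N v ∩ S ∣ < r
  ∉-step⁻ v∉ = (v∉ ∘ ∈-step⁺ ∘ inj₁) , ≰⇒> (v∉ ∘ ∈-step⁺ ∘ inj₂)

  ∁step⊆⋃nonNeighbours : ∀ {r A} → ∣ A ∣ ≡ r → ∁ (step G r A) ⊆ ⋃∈ A nonNeighbours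
  ∁step⊆⋃nonNeighbours {A = A} ∣A∣≡r {w} w∈∁ with ∉-step⁻ (x∈∁p⇒x∉p w∈∁)
  ... | w∉A , few with ∣q∩p∣<∣p∣⇒∃ A (N w) (subst (∣ N w ∩ A ∣ <_) (sym ∣A∣≡r) few)
  ...   | a , a∈A , a∉N[w] = x∈⋃∈⁺ a∈A (∈nonNeighbours (a∉N[w] ∘ ∈N-sym) λ { refl → w∉A a∈A })

  ∣∁step∣≤r*k : ∀ {k r A} → minDegree≥ G (n ∸ suc k) → ∣ A ∣ ≡ r → ∣ ∁ (step G r A) ∣ ≤ r * k
  ∣∁step∣≤r*k {k} {r} {A} δ≥ ∣A∣≡r =
    ≤-trans (p⊆q⇒∣p∣≤∣q∣ (∁step⊆⋃nonNeighbours {A = A} ∣A∣≡r))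
    (subst (λ m → ∣ ⋃∈ A nonNeighbours ∣ ≤ m * k) ∣A∣≡r
      (∣⋃∈∣≤∣A∣* A nonNeighbours k (s≤s⁻¹ ∘ ∣nonNeighbours∣<k δ≥)))

  ∣S∣≤∣N∩S∣+∣nonNeighbours∣ : ∀ {S v} → v ∉ S → ∣ S ∣ ≤ ∣ N v ∩ S ∣ + ∣ nonNeighbours v ∣
  ∣S∣≤∣N∩S∣+∣nonNeighbours∣ {S} {v} v∉S = ≤-trans (p⊆q⇒∣p∣≤∣q∣ S⊆) (∣p∪q∣≤∣p∣+∣q∣ (N v ∩ S) _)
    where
    S⊆ : S ⊆ (N v ∩ S) ∪ nonNeighbours v
    S⊆ {w} w∈S with w ∈? N v
    ... | yes w∈N = x∈p∪q⁺ (inj₁ (x∈p∩q⁺ (w∈N , w∈S)))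
    ... | no  w∉N = x∈p∪q⁺ (inj₂ (∈nonNeighbours w∉N λ { refl → v∉S w∈S }))

  r≤∣N∩S∣ : ∀ {k r c S v} → minDegree≥ G (n ∸ suc k) → r + (k + c) ≤ n → ∣ ∁ S ∣ ≤ c →
    v ∉ S → r ≤ ∣ N v ∩ S ∣
  r≤∣N∩S∣ {k} {r} {c} {S} {v} δ≥ r+k+c≤n ∣∁S∣≤c v∉S = +-cancelʳ-≤ (k + c) r X (begin
      r + (k + c)                          ≤⟨ r+k+c≤n ⟩
      n                                    ≡⟨ sym (∣p∣+∣∁p∣≡n S) ⟩
      ∣ S ∣ + ∣ ∁ S ∣                      ≤⟨ +-mono-≤ (∣S∣≤∣N∩S∣+∣nonNeighbours∣ v∉S) ∣∁S∣≤c ⟩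
      (X + ∣ nonNeighbours v ∣) + c        ≤⟨ +-monoˡ-≤ c (+-monoʳ-≤ X (s≤s⁻¹ (∣nonNeighbours∣<k δ≥ v))) ⟩
      (X + k) + c                          ≡⟨ +-assoc X k c ⟩
      X + (k + c)                          ∎)
    where
    X : ℕ
    X = ∣ N v ∩ S ∣
    open ≤-Reasoning

  ∀∈step : ∀ {r S} → (∀ v → v ∉ S → r ≤ ∣ N v ∩ S ∣) → ∀ v → v ∈ step G r S
  ∀∈step {S = S} many v with v ∈? S
  ... | yes v∈S = ∈-step⁺ (inj₁ v∈S)
  ... | no  v∉S = ∈-step⁺ (inj₂ (many v v∉S))

suc[r+[k+r*k]]≡[1+k]*[r+1] : ∀ r k → suc (r + (k + r * k)) ≡ suc k * (r + 1)
suc[r+[k+r*k]]≡[1+k]*[r+1] = solve-∀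

lemma4p1 : (k r n : ℕ) → 3 ≤ r → k * (r + 1) ∸ 1 ≤ n →
    (G : Graph n) → minDegree≥ G (n ∸ k) →
    (A : Subset n) → ∣ A ∣ ≡ r → Percolates G r A
lemma4p1 zero    r n _ _ G δ≥ A _ v = ⊥-elim (n≮0 (∣nonNeighbours∣<k G δ≥ v))
lemma4p1 (suc k) r n _ bound G δ≥ A ∣A∣≡r v =
  2 , ∀∈step G {S = A₁} (λ w → r≤∣N∩S∣ G δ≥ r+k+rk≤n (∣∁step∣≤r*k G {A = A} δ≥ ∣A∣≡r)) v
  where
  A₁ : Subset n
  A₁ = step G r A

  r+k+rk≤n : r + (k + r * k) ≤ n
  r+k+rk≤n = ≤-trans (≤-reflexive (cong (_∸ 1) (suc[r+[k+r*k]]≡[1+k]*[r+1] r k))) bound
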